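{- Let $L$ be a $3$-Engel Lie algebra over $\mathbb{F}_5$ and let $k,l$ be integers with $l>k>1$. Then there is no tuple $(z_0,z_1,z_2,z_3)\in L^4$ satisfying both $\phi_k(z_0,z_1,z_2,z_3)$ and $\psi_l(z_0,z_1,z_2,z_3)$.
   Context: Brackets are left-normed: $[a_1,\ldots,a_n]=[\ldots[[a_1,a_2],a_3],\ldots,a_n]$. A Lie algebra $L$ is $3$-Engel if $[a,b,b,b]=0$ for all $a,b\in L$. For $z_0,x_1,\ldots,x_n\in L$ write $f_{z_0}(x_1,\ldots,x_n)=[z_0,w,w]$ with $w=[x_1,\ldots,x_n]$. For an integer $k>1$, $\phi_k(z_0,z_1,z_2,z_3)$ is the statement: there exist $y_1,\ldots,y_{k+1}\in L$ such that $f_{z_0}(z_2,z_3,y_1)\neq0$, $f_{z_0}(z_1,y_i)=f_{z_0}(z_2,y_{i+1})$ for all $1\leq i\leq k$, and $f_{z_0}(z_1,y_{k+1})=0$. And $\psi_k(z_0,z_1,z_2,z_3)$ is the statement: there exist $x_1,\ldots,x_k\in L$ such that $f_{z_0}(z_2,z_3)=f_{z_0}(x_1,z_1)$ and $f_{z_0}(x_i,z_2)=f_{z_0}(x_{i+1},z_1)$ for all $1\leq i\leq k-1$. -}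

module Defs where

open import Level using (Level; _⊔_; suc)
open import Data.Nat using (ℕ; zero)
import Data.Nat as ℕ
open import Data.Nat.DivMod using (_%_)
open import Data.Fin using (Fin; toℕ; fromℕ<)
open import Data.Fin.Properties using (all?; _≟_)
open import Data.Nat.DivMod using (m%n<n)
open import Data.Product using (Σ; _×_; _,_)
open import Relation.Binary.PropositionalEquality using (_≡_; refl; isEquivalence; cong₂; cong)
open import Relation.Nullary using (¬_)
open import Relation.Nullary.Decidable using (from-yes)
open import Algebra.Bundles using (CommutativeRing)
open import Algebra.Structures using (IsCommutativeRing)
open import Algebra.Module.Bundles using (Module)

F₅ : Set
F₅ = Fin 5

infixl 6 _+₅_
infixl 7 _*₅_

_+₅_ : F₅ → F₅ → F₅
a +₅ b = fromℕ< (m%n<n (toℕ a ℕ.+ toℕ b) 5)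

_*₅_ : F₅ → F₅ → F₅
a *₅ b = fromℕ< (m%n<n (toℕ a ℕ.* toℕ b) 5)

-₅_ : F₅ → F₅
-₅ a = fromℕ< (m%n<n (4 ℕ.* toℕ a) 5)

0₅ 1₅ : F₅
0₅ = Fin.zero
1₅ = Fin.suc Fin.zero

private
  +₅-assoc : ∀ a b c → (a +₅ b) +₅ c ≡ a +₅ (b +₅ c)
  +₅-assoc = from-yes (all? λ a → all? λ b → all? λ c → ((a +₅ b) +₅ c) ≟ (a +₅ (b +₅ c)))
  *₅-assoc : ∀ a b c → (a *₅ b) *₅ c ≡ a *₅ (b *₅ c)
  *₅-assoc = from-yes (all? λ a → all? λ b → all? λ c → ((a *₅ b) *₅ c) ≟ (a *₅ (b *₅ c)))
  +₅-comm : ∀ a b → a +₅ b ≡ b +₅ a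
  +₅-comm = from-yes (all? λ a → all? λ b → (a +₅ b) ≟ (b +₅ a))
  *₅-comm : ∀ a b → a *₅ b ≡ b *₅ a
  *₅-comm = from-yes (all? λ a → all? λ b → (a *₅ b) ≟ (b *₅ a))
  +₅-idˡ : ∀ a → 0₅ +₅ a ≡ a
  +₅-idˡ = from-yes (all? λ a → (0₅ +₅ a) ≟ a)
  +₅-idʳ : ∀ a → a +₅ 0₅ ≡ a
  +₅-idʳ = from-yes (all? λ a → (a +₅ 0₅) ≟ a)
  *₅-idˡ : ∀ a → 1₅ *₅ a ≡ a
  *₅-idˡ = from-yes (all? λ a → (1₅ *₅ a) ≟ a)
  *₅-idʳ : ∀ a → a *₅ 1₅ ≡ a
  *₅-idʳ = from-yes (all? λ a → (a *₅ 1₅) ≟ a)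
  -₅-invˡ : ∀ a → (-₅ a) +₅ a ≡ 0₅
  -₅-invˡ = from-yes (all? λ a → ((-₅ a) +₅ a) ≟ 0₅)
  -₅-invʳ : ∀ a → a +₅ (-₅ a) ≡ 0₅
  -₅-invʳ = from-yes (all? λ a → (a +₅ (-₅ a)) ≟ 0₅)
  distribˡ : ∀ a b c → a *₅ (b +₅ c) ≡ (a *₅ b) +₅ (a *₅ c)
  distribˡ = from-yes (all? λ a → all? λ b → all? λ c → (a *₅ (b +₅ c)) ≟ ((a *₅ b) +₅ (a *₅ c)))
  distribʳ : ∀ a b c → (b +₅ c) *₅ a ≡ (b *₅ a) +₅ (c *₅ a)
  distribʳ = from-yes (all? λ a → all? λ b → all? λ c → ((b +₅ c) *₅ a) ≟ ((b *₅ a) +₅ (c *₅ a)))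

  F₅-isCommutativeRing : IsCommutativeRing _≡_ _+₅_ _*₅_ -₅_ 0₅ 1₅
  F₅-isCommutativeRing = record
    { isRing = record
      { +-isAbelianGroup = record
        { isGroup = record
          { isMonoid = record
            { isSemigroup = record
              { isMagma = record { isEquivalence = isEquivalence ; ∙-cong = cong₂ _+₅_ }
              ; assoc = +₅-assoc }
            ; identity = +₅-idˡ , +₅-idʳ }
          ; inverse = -₅-invˡ , -₅-invʳ
          ; ⁻¹-cong = cong -₅_ }
        ; comm = +₅-comm }
      ; *-cong = cong₂ _*₅_
      ; *-assoc = *₅-assoc
      ; *-identity = *₅-idˡ , *₅-idʳ
      ; distrib = distribˡ , distribʳ }
    ; *-comm = *₅-comm }

𝔽₅ : CommutativeRing Level.zero Level.zero
𝔽₅ = record { isCommutativeRing = F₅-isCommutativeRing }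

record LieAlgebra (m ℓ : Level) : Set (suc (m ⊔ ℓ)) where
  field
    module′ : Module 𝔽₅ m ℓ
  open Module module′ public
  infixl 9 ⁅_,_⁆
  field
    ⁅_,_⁆     : Carrierᴹ → Carrierᴹ → Carrierᴹ
    ⁅⁆-cong   : ∀ {a a′ b b′} → a ≈ᴹ a′ → b ≈ᴹ b′ → ⁅ a , b ⁆ ≈ᴹ ⁅ a′ , b′ ⁆
    ⁅⁆-+ˡ     : ∀ a b c → ⁅ a +ᴹ b , c ⁆ ≈ᴹ ⁅ a , c ⁆ +ᴹ ⁅ b , c ⁆
    ⁅⁆-+ʳ     : ∀ a b c → ⁅ a , b +ᴹ c ⁆ ≈ᴹ ⁅ a , b ⁆ +ᴹ ⁅ a , c ⁆
    ⁅⁆-*ˡ     : ∀ (r : F₅) a b → ⁅ r *ₗ a , b ⁆ ≈ᴹ r *ₗ ⁅ a , b ⁆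
    ⁅⁆-*ʳ     : ∀ (r : F₅) a b → ⁅ a , r *ₗ b ⁆ ≈ᴹ r *ₗ ⁅ a , b ⁆
    alternate : ∀ a → ⁅ a , a ⁆ ≈ᴹ 0ᴹ
    jacobi    : ∀ a b c →
                ⁅ ⁅ a , b ⁆ , c ⁆ +ᴹ ⁅ ⁅ b , c ⁆ , a ⁆ +ᴹ ⁅ ⁅ c , a ⁆ , b ⁆ ≈ᴹ 0ᴹ

module _ {m ℓ : Level} (L : LieAlgebra m ℓ) where
  open LieAlgebra L

  Is3Engel : Set (m ⊔ ℓ)
  Is3Engel = ∀ a b → ⁅ ⁅ ⁅ a , b ⁆ , b ⁆ , b ⁆ ≈ᴹ 0ᴹ

  f : Carrierᴹ → Carrierᴹ → Carrierᴹ
  f z₀ w = ⁅ ⁅ z₀ , w ⁆ , w ⁆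

  -- φ_k(z₀,z₁,z₂,z₃): ∃ y₁,…,y_{k+1} (indexed y 1 … y (k+1); y 0 unused) with
  -- f_{z₀}([z₂,z₃,y₁]) ≠ 0, f_{z₀}([z₁,y_i]) = f_{z₀}([z₂,y_{i+1}]) for 1 ≤ i ≤ k,
  -- and f_{z₀}([z₁,y_{k+1}]) = 0.
  φ : ℕ → Carrierᴹ → Carrierᴹ → Carrierᴹ → Carrierᴹ → Set (m ⊔ ℓ)
  φ k z₀ z₁ z₂ z₃ =
    Σ (ℕ → Carrierᴹ) λ y → ( (¬ (f z₀ ⁅ ⁅ z₂ , z₃ ⁆ , y 1 ⁆ ≈ᴹ 0ᴹ))
           × (∀ i → 1 ℕ.≤ i → i ℕ.≤ k →
                f z₀ ⁅ z₁ , y i ⁆ ≈ᴹ f z₀ ⁅ z₂ , y (ℕ.suc i) ⁆)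
           × (f z₀ ⁅ z₁ , y (ℕ.suc k) ⁆ ≈ᴹ 0ᴹ) )

  ψ : ℕ → Carrierᴹ → Carrierᴹ → Carrierᴹ → Carrierᴹ → Set (m ⊔ ℓ)
  ψ k z₀ z₁ z₂ z₃ =
    Σ (ℕ → Carrierᴹ) λ x → ( (f z₀ ⁅ z₂ , z₃ ⁆ ≈ᴹ f z₀ ⁅ x 1 , z₁ ⁆)
           × (∀ i → 1 ℕ.≤ i → ℕ.suc i ℕ.≤ k →
                f z₀ ⁅ x i , z₂ ⁆ ≈ᴹ f z₀ ⁅ x (ℕ.suc i) , z₁ ⁆) )

-- Write f_z(w) = [z,w,w].  In a 3-Engel Lie algebra over 𝔽₅ the linearised
-- Engel identities give f_z([a,b]) = −f_{f_z(a)}(b).  As f_z([a,b]) = f_z([b,a])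
-- and f_{f_z(a)}(b) = f_{f_z(b)}(a), the quantity Q(a,b,c) = f_{f_z([a,b])}(c) is
-- symmetric in a, b, c.  The equations of φ_k and ψ_l then make
-- Q(x_i, z₁, y_i) constant for 1 ≤ i ≤ k + 1; it equals Q(z₂, z₃, y₁) at the start
-- and vanishes at the end, so f_{z₀}([z₂,z₃,y₁]) = −Q(z₂, z₃, y₁) = 0, contradicting φ_k.
module Submission where

open import Defs
open import Level using (Level)
open import Data.Nat using (ℕ; _<_)
open import Data.Product using (_×_)
open import Relation.Nullary using (¬_)

open import Algebra.Bundles using (CommutativeMonoid)
open import Data.Fin using (Fin; #_)
import Data.Fin.Properties as Finₚ
open import Data.List using (List; []; _∷_; [_]; _++_; map)
open import Data.List.Properties using (≡-dec)
open import Data.List.Relation.Unary.All using (All; []; _∷_; all?)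
open import Data.Nat using (suc; zero; _≤_; s≤s; z≤n)
open import Data.Nat.Properties using (≤-trans; ≤-refl; m≤n⇒m≤1+n)
open import Data.Product using (Σ; _,_; proj₁; map₁; map₂)
open import Data.Vec using (lookup)
import Data.Vec as Vec
open import Relation.Binary.Bundles using (Setoid)
open import Relation.Binary.Definitions using (DecidableEquality)
open import Relation.Binary.PropositionalEquality using (_≡_; refl; cong)
open import Relation.Nullary using (Dec; yes; no)
open import Relation.Nullary.Decidable using (True; toWitness)

telescope : ∀ {c ℓ} (S : Setoid c ℓ) (s : ℕ → Setoid.Carrier S) (k : ℕ) →
            (∀ i → 1 ≤ i → i ≤ k → Setoid._≈_ S (s i) (s (suc i))) →
            Setoid._≈_ S (s 1) (s (suc k))
telescope S s zero    step = Setoid.refl S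
telescope S s (suc k) step =
  Setoid.trans S (telescope S s k (λ i 1≤i i≤k → step i 1≤i (m≤n⇒m≤1+n i≤k)))
                 (step (suc k) (s≤s z≤n) ≤-refl)

-1₅ : F₅
-1₅ = -₅ 1₅

infixl 8 _⊕_
data Term (n : ℕ) : Set where
  var    : Fin n → Term n
  _⊕_    : Term n → Term n → Term n
  ⁅_,_⁆ₜ : Term n → Term n → Term n

-- Lie terms of degree one in an extra variable ẑ: t ◂ a is ⁅ t , a ⁆, a ▸ t is ⁅ a , t ⁆.
infixl 6 _◂_
infixr 7 _▸_
data ZTerm (n : ℕ) : Set where
  ẑ   : ZTerm n
  _◂_ : ZTerm n → Term n → ZTerm n
  _▸_ : Term n → ZTerm n → ZTerm n

Comb : ∀ {a} → Set a → Set a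
Comb X = List (F₅ × X)

infixr 7 _·_
_·_ : ∀ {a} {X : Set a} → F₅ → Comb X → Comb X
r · p = map (map₁ (r *₅_)) p

-- A degree-one term in ẑ is normalised to ẑ acted on by a combination of words
-- in the maps ad (var i); words are stored last letter first.
Word : ℕ → Set
Word n = List (Fin n)

infixl 6 _⋆_
_⋆_ : ∀ {n} → Comb (Word n) → Term n → Comb (Word n)
p ⋆ var i      = map (map₂ (i ∷_)) p
p ⋆ (s ⊕ t)    = p ⋆ s ++ p ⋆ t
p ⋆ ⁅ s , t ⁆ₜ = p ⋆ s ⋆ t ++ -1₅ · (p ⋆ t ⋆ s)

operator : ∀ {n} → ZTerm n → Comb (Word n)
operator ẑ       = [ 1₅ , [] ]
operator (t ◂ a) = operator t ⋆ a
operator (a ▸ t) = -1₅ · (operator t ⋆ a)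

expand : ∀ {n} → Comb (ZTerm n) → Comb (Word n)
expand []            = []
expand ((c , t) ∷ p) = c · operator t ++ expand p

module _ {a} {X : Set a} (_≟_ : DecidableEquality X) where

  insert : F₅ → X → Comb X → Comb X
  insert c x [] = [ c , x ]
  insert c x ((d , y) ∷ p) with x ≟ y
  ... | yes _ = (c +₅ d , y) ∷ p
  ... | no _  = (d , y) ∷ insert c x p

  collect : Comb X → Comb X
  collect []            = []
  collect ((c , x) ∷ p) = insert c x (collect p)

Vanishes : ∀ {a} {X : Set a} → Comb X → Set a
Vanishes = All (λ e → proj₁ e ≡ 0₅)

vanishes? : ∀ {a} {X : Set a} (p : Comb X) → Dec (Vanishes p)
vanishes? = all? (λ e → proj₁ e Finₚ.≟ 0₅)

normalForm : ∀ {n} → Comb (ZTerm n) → Comb (Word n)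
normalForm p = collect (≡-dec Finₚ._≟_) (expand p)

linearised : ∀ {n} → ZTerm n → Term n → Term n → Term n → Comb (ZTerm n)
linearised x a b c = map (1₅ ,_)
  ( x ◂ a ◂ b ◂ c ∷ x ◂ a ◂ c ◂ b ∷ x ◂ b ◂ a ◂ c
  ∷ x ◂ b ◂ c ◂ a ∷ x ◂ c ◂ a ◂ b ∷ x ◂ c ◂ b ◂ a ∷ [])

linearised-arg : ∀ {n} → Term n → ZTerm n → Term n → Term n → Comb (ZTerm n)
linearised-arg x a b c = map (1₅ ,_)
  ( x ▸ a ◂ b ◂ c ∷ x ▸ a ◂ c ◂ b ∷ ⁅ x , b ⁆ₜ ▸ a ◂ c
  ∷ ⁅ ⁅ x , b ⁆ₜ , c ⁆ₜ ▸ a ∷ ⁅ x , c ⁆ₜ ▸ a ◂ b ∷ ⁅ ⁅ x , c ⁆ₜ , b ⁆ₜ ▸ a ∷ [])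

module Properties {m ℓ : Level} (L : LieAlgebra m ℓ) where
  open LieAlgebra L
  open import Relation.Binary.Reasoning.Setoid ≈ᴹ-setoid
  open import Algebra.Properties.AbelianGroup +ᴹ-abelianGroup
    using (inverseˡ-unique; inverseʳ-unique; x∙y⁻¹≈ε⇒x≈y; ε⁻¹≈ε)
  open import Algebra.Properties.CommutativeSemigroup
    (CommutativeMonoid.commutativeSemigroup +ᴹ-commutativeMonoid)
    using (xy∙z≈xz∙y; x∙yz≈y∙xz)

  -1₅*ₗ≈-ᴹ : ∀ x → -1₅ *ₗ x ≈ᴹ -ᴹ x
  -1₅*ₗ≈-ᴹ x = inverseʳ-unique x (-1₅ *ₗ x) (begin
    x +ᴹ -1₅ *ₗ x        ≈⟨ +ᴹ-congʳ (*ₗ-identityˡ x) ⟨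
    1₅ *ₗ x +ᴹ -1₅ *ₗ x  ≈⟨ *ₗ-distribʳ x 1₅ -1₅ ⟨
    0₅ *ₗ x              ≈⟨ *ₗ-zeroˡ x ⟩
    0ᴹ                   ∎)

  ⁅⁆-zeroˡ : ∀ x → ⁅ 0ᴹ , x ⁆ ≈ᴹ 0ᴹ
  ⁅⁆-zeroˡ x = begin
    ⁅ 0ᴹ , x ⁆        ≈⟨ ⁅⁆-cong (*ₗ-zeroˡ 0ᴹ) ≈ᴹ-refl ⟨
    ⁅ 0₅ *ₗ 0ᴹ , x ⁆  ≈⟨ ⁅⁆-*ˡ 0₅ 0ᴹ x ⟩
    0₅ *ₗ ⁅ 0ᴹ , x ⁆  ≈⟨ *ₗ-zeroˡ _ ⟩
    0ᴹ                ∎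

  ⁅⁆-negˡ : ∀ x y → ⁅ -ᴹ x , y ⁆ ≈ᴹ -ᴹ ⁅ x , y ⁆
  ⁅⁆-negˡ x y = begin
    ⁅ -ᴹ x , y ⁆        ≈⟨ ⁅⁆-cong (-1₅*ₗ≈-ᴹ x) ≈ᴹ-refl ⟨
    ⁅ -1₅ *ₗ x , y ⁆    ≈⟨ ⁅⁆-*ˡ -1₅ x y ⟩
    -1₅ *ₗ ⁅ x , y ⁆    ≈⟨ -1₅*ₗ≈-ᴹ _ ⟩
    -ᴹ ⁅ x , y ⁆        ∎

  ⁅⁆-anticomm : ∀ a b → ⁅ a , b ⁆ ≈ᴹ -1₅ *ₗ ⁅ b , a ⁆
  ⁅⁆-anticomm a b = begin
    ⁅ a , b ⁆         ≈⟨ inverseˡ-unique _ _ sum≈0 ⟩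
    -ᴹ ⁅ b , a ⁆      ≈⟨ -1₅*ₗ≈-ᴹ _ ⟨
    -1₅ *ₗ ⁅ b , a ⁆  ∎
    where
    sum≈0 : ⁅ a , b ⁆ +ᴹ ⁅ b , a ⁆ ≈ᴹ 0ᴹ
    sum≈0 = begin
      ⁅ a , b ⁆ +ᴹ ⁅ b , a ⁆
        ≈⟨ +ᴹ-cong (+ᴹ-identityˡ _) (+ᴹ-identityʳ _) ⟨
      (0ᴹ +ᴹ ⁅ a , b ⁆) +ᴹ (⁅ b , a ⁆ +ᴹ 0ᴹ)
        ≈⟨ +ᴹ-cong (+ᴹ-congʳ (alternate a)) (+ᴹ-congˡ (alternate b)) ⟨
      (⁅ a , a ⁆ +ᴹ ⁅ a , b ⁆) +ᴹ (⁅ b , a ⁆ +ᴹ ⁅ b , b ⁆)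
        ≈⟨ +ᴹ-cong (⁅⁆-+ʳ a a b) (⁅⁆-+ʳ b a b) ⟨
      ⁅ a , a +ᴹ b ⁆ +ᴹ ⁅ b , a +ᴹ b ⁆
        ≈⟨ ⁅⁆-+ˡ a b (a +ᴹ b) ⟨
      ⁅ a +ᴹ b , a +ᴹ b ⁆
        ≈⟨ alternate (a +ᴹ b) ⟩
      0ᴹ ∎

  ⁅⁆-jacobiʳ : ∀ x a b → ⁅ x , ⁅ a , b ⁆ ⁆ ≈ᴹ ⁅ ⁅ x , a ⁆ , b ⁆ +ᴹ -1₅ *ₗ ⁅ ⁅ x , b ⁆ , a ⁆
  ⁅⁆-jacobiʳ x a b = begin
    ⁅ x , ⁅ a , b ⁆ ⁆  ≈⟨ ⁅⁆-anticomm x ⁅ a , b ⁆ ⟩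
    -1₅ *ₗ B           ≈⟨ -1₅*ₗ≈-ᴹ B ⟩
    -ᴹ B               ≈⟨ inverseˡ-unique (A +ᴹ C) B (≈ᴹ-trans (xy∙z≈xz∙y A C B) (jacobi x a b)) ⟨
    A +ᴹ C             ≈⟨ +ᴹ-congˡ C≈ ⟩
    A +ᴹ -1₅ *ₗ ⁅ ⁅ x , b ⁆ , a ⁆ ∎
    where
    A = ⁅ ⁅ x , a ⁆ , b ⁆
    B = ⁅ ⁅ a , b ⁆ , x ⁆
    C = ⁅ ⁅ b , x ⁆ , a ⁆
    C≈ : C ≈ᴹ -1₅ *ₗ ⁅ ⁅ x , b ⁆ , a ⁆
    C≈ = ≈ᴹ-trans (⁅⁆-cong (⁅⁆-anticomm b x) ≈ᴹ-refl) (⁅⁆-*ˡ -1₅ _ a)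

  f-congˡ : ∀ {x y} c → x ≈ᴹ y → f L x c ≈ᴹ f L y c
  f-congˡ c x≈y = ⁅⁆-cong (⁅⁆-cong x≈y ≈ᴹ-refl) ≈ᴹ-refl

  f-zeroˡ : ∀ c → f L 0ᴹ c ≈ᴹ 0ᴹ
  f-zeroˡ c = ≈ᴹ-trans (⁅⁆-cong (⁅⁆-zeroˡ c) ≈ᴹ-refl) (⁅⁆-zeroˡ c)

  f-negˡ : ∀ x c → f L (-ᴹ x) c ≈ᴹ -ᴹ f L x c
  f-negˡ x c = ≈ᴹ-trans (⁅⁆-cong (⁅⁆-negˡ x c) ≈ᴹ-refl) (⁅⁆-negˡ _ c)

  eval : ∀ {a} {X : Set a} → (X → Carrierᴹ) → Comb X → Carrierᴹ
  eval v []            = 0ᴹ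
  eval v ((c , x) ∷ p) = c *ₗ v x +ᴹ eval v p

  module _ {a} {X : Set a} (v : X → Carrierᴹ) where

    eval-++ : ∀ p q → eval v (p ++ q) ≈ᴹ eval v p +ᴹ eval v q
    eval-++ []            q = ≈ᴹ-sym (+ᴹ-identityˡ _)
    eval-++ ((c , x) ∷ p) q = ≈ᴹ-trans (+ᴹ-congˡ (eval-++ p q)) (≈ᴹ-sym (+ᴹ-assoc _ _ _))

    eval-· : ∀ r p → eval v (r · p) ≈ᴹ r *ₗ eval v p
    eval-· r []            = ≈ᴹ-sym (*ₗ-zeroʳ r)
    eval-· r ((c , x) ∷ p) = begin
      (r *₅ c) *ₗ v x +ᴹ eval v (r · p)  ≈⟨ +ᴹ-cong (*ₗ-assoc r c (v x)) (eval-· r p) ⟩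
      r *ₗ (c *ₗ v x) +ᴹ r *ₗ eval v p   ≈⟨ *ₗ-distribˡ r _ _ ⟨
      r *ₗ (c *ₗ v x +ᴹ eval v p)        ∎

    eval-map₂ : ∀ {b} {Y : Set b} (g : Y → X) p → eval v (map (map₂ g) p) ≡ eval (λ y → v (g y)) p
    eval-map₂ g []            = refl
    eval-map₂ g ((c , y) ∷ p) = cong (c *ₗ v (g y) +ᴹ_) (eval-map₂ g p)

    eval-⁅⁆ˡ : ∀ p b → eval (λ x → ⁅ v x , b ⁆) p ≈ᴹ ⁅ eval v p , b ⁆
    eval-⁅⁆ˡ []            b = ≈ᴹ-sym (⁅⁆-zeroˡ b)
    eval-⁅⁆ˡ ((c , x) ∷ p) b = begin
      c *ₗ ⁅ v x , b ⁆ +ᴹ eval (λ x → ⁅ v x , b ⁆) p  ≈⟨ +ᴹ-cong (≈ᴹ-sym (⁅⁆-*ˡ c (v x) b)) (eval-⁅⁆ˡ p b) ⟩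
      ⁅ c *ₗ v x , b ⁆ +ᴹ ⁅ eval v p , b ⁆           ≈⟨ ⁅⁆-+ˡ _ _ b ⟨
      ⁅ c *ₗ v x +ᴹ eval v p , b ⁆                   ∎

    eval-vanishing : ∀ p → Vanishes p → eval v p ≈ᴹ 0ᴹ
    eval-vanishing []            []          = ≈ᴹ-refl
    eval-vanishing ((c , x) ∷ p) (refl ∷ p0) = begin
      0₅ *ₗ v x +ᴹ eval v p  ≈⟨ +ᴹ-cong (*ₗ-zeroˡ (v x)) (eval-vanishing p p0) ⟩
      0ᴹ +ᴹ 0ᴹ               ≈⟨ +ᴹ-identityˡ 0ᴹ ⟩
      0ᴹ                     ∎

    module _ (_≟_ : DecidableEquality X) where

      eval-insert : ∀ c x p → eval v (insert _≟_ c x p) ≈ᴹ c *ₗ v x +ᴹ eval v p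
      eval-insert c x [] = ≈ᴹ-refl
      eval-insert c x ((d , y) ∷ p) with x ≟ y
      ... | yes refl = begin
        (c +₅ d) *ₗ v x +ᴹ eval v p          ≈⟨ +ᴹ-congʳ (*ₗ-distribʳ (v x) c d) ⟩
        (c *ₗ v x +ᴹ d *ₗ v x) +ᴹ eval v p   ≈⟨ +ᴹ-assoc _ _ _ ⟩
        c *ₗ v x +ᴹ (d *ₗ v x +ᴹ eval v p)   ∎
      ... | no _ = begin
        d *ₗ v y +ᴹ eval v (insert _≟_ c x p)  ≈⟨ +ᴹ-congˡ (eval-insert c x p) ⟩
        d *ₗ v y +ᴹ (c *ₗ v x +ᴹ eval v p)     ≈⟨ x∙yz≈y∙xz _ _ _ ⟩
        c *ₗ v x +ᴹ (d *ₗ v y +ᴹ eval v p)     ∎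

      eval-collect : ∀ p → eval v (collect _≟_ p) ≈ᴹ eval v p
      eval-collect []            = ≈ᴹ-refl
      eval-collect ((c , x) ∷ p) =
        ≈ᴹ-trans (eval-insert c x (collect _≟_ p)) (+ᴹ-congˡ (eval-collect p))

  module Semantics {n : ℕ} (z : Carrierᴹ) (ρ : Fin n → Carrierᴹ) where

    ⟦_⟧ : Term n → Carrierᴹ
    ⟦ var i ⟧      = ρ i
    ⟦ s ⊕ t ⟧      = ⟦ s ⟧ +ᴹ ⟦ t ⟧
    ⟦ ⁅ s , t ⁆ₜ ⟧ = ⁅ ⟦ s ⟧ , ⟦ t ⟧ ⁆

    ⟦_⟧ᶻ : ZTerm n → Carrierᴹ
    ⟦ ẑ ⟧ᶻ     = z
    ⟦ t ◂ a ⟧ᶻ = ⁅ ⟦ t ⟧ᶻ , ⟦ a ⟧ ⁆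
    ⟦ a ▸ t ⟧ᶻ = ⁅ ⟦ a ⟧ , ⟦ t ⟧ᶻ ⁆

    ⟦_⟧ʷ : Word n → Carrierᴹ
    ⟦ [] ⟧ʷ    = z
    ⟦ i ∷ w ⟧ʷ = ⁅ ⟦ w ⟧ʷ , ρ i ⁆

    ⋆-sound : ∀ p t → eval ⟦_⟧ʷ (p ⋆ t) ≈ᴹ ⁅ eval ⟦_⟧ʷ p , ⟦ t ⟧ ⁆
    ⋆-sound p (var i) = begin
      eval ⟦_⟧ʷ (map (map₂ (i ∷_)) p)   ≡⟨ eval-map₂ ⟦_⟧ʷ (i ∷_) p ⟩
      eval (λ w → ⁅ ⟦ w ⟧ʷ , ρ i ⁆) p  ≈⟨ eval-⁅⁆ˡ ⟦_⟧ʷ p (ρ i) ⟩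
      ⁅ eval ⟦_⟧ʷ p , ρ i ⁆            ∎
    ⋆-sound p (s ⊕ t) = begin
      eval ⟦_⟧ʷ (p ⋆ s ++ p ⋆ t)               ≈⟨ eval-++ ⟦_⟧ʷ (p ⋆ s) (p ⋆ t) ⟩
      eval ⟦_⟧ʷ (p ⋆ s) +ᴹ eval ⟦_⟧ʷ (p ⋆ t)  ≈⟨ +ᴹ-cong (⋆-sound p s) (⋆-sound p t) ⟩
      ⁅ eval ⟦_⟧ʷ p , ⟦ s ⟧ ⁆ +ᴹ ⁅ eval ⟦_⟧ʷ p , ⟦ t ⟧ ⁆  ≈⟨ ⁅⁆-+ʳ _ _ _ ⟨
      ⁅ eval ⟦_⟧ʷ p , ⟦ s ⟧ +ᴹ ⟦ t ⟧ ⁆                    ∎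
    ⋆-sound p ⁅ s , t ⁆ₜ = begin
      eval ⟦_⟧ʷ (p ⋆ s ⋆ t ++ -1₅ · (p ⋆ t ⋆ s))
        ≈⟨ eval-++ ⟦_⟧ʷ (p ⋆ s ⋆ t) (-1₅ · (p ⋆ t ⋆ s)) ⟩
      eval ⟦_⟧ʷ (p ⋆ s ⋆ t) +ᴹ eval ⟦_⟧ʷ (-1₅ · (p ⋆ t ⋆ s))
        ≈⟨ +ᴹ-congˡ (eval-· ⟦_⟧ʷ -1₅ (p ⋆ t ⋆ s)) ⟩
      eval ⟦_⟧ʷ (p ⋆ s ⋆ t) +ᴹ -1₅ *ₗ eval ⟦_⟧ʷ (p ⋆ t ⋆ s)
        ≈⟨ +ᴹ-cong (≈ᴹ-trans (⋆-sound (p ⋆ s) t) (⁅⁆-cong (⋆-sound p s) ≈ᴹ-refl))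
                   (*ₗ-congˡ (≈ᴹ-trans (⋆-sound (p ⋆ t) s) (⁅⁆-cong (⋆-sound p t) ≈ᴹ-refl))) ⟩
      ⁅ ⁅ P , ⟦ s ⟧ ⁆ , ⟦ t ⟧ ⁆ +ᴹ -1₅ *ₗ ⁅ ⁅ P , ⟦ t ⟧ ⁆ , ⟦ s ⟧ ⁆
        ≈⟨ ⁅⁆-jacobiʳ P ⟦ s ⟧ ⟦ t ⟧ ⟨
      ⁅ P , ⁅ ⟦ s ⟧ , ⟦ t ⟧ ⁆ ⁆ ∎
      where P = eval ⟦_⟧ʷ p

    operator-sound : ∀ t → ⟦ t ⟧ᶻ ≈ᴹ eval ⟦_⟧ʷ (operator t)
    operator-sound ẑ       = ≈ᴹ-sym (≈ᴹ-trans (+ᴹ-identityʳ _) (*ₗ-identityˡ z))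
    operator-sound (t ◂ a) =
      ≈ᴹ-trans (⁅⁆-cong (operator-sound t) ≈ᴹ-refl) (≈ᴹ-sym (⋆-sound (operator t) a))
    operator-sound (a ▸ t) = begin
      ⁅ ⟦ a ⟧ , ⟦ t ⟧ᶻ ⁆                          ≈⟨ ⁅⁆-anticomm _ _ ⟩
      -1₅ *ₗ ⁅ ⟦ t ⟧ᶻ , ⟦ a ⟧ ⁆                   ≈⟨ *ₗ-congˡ (⁅⁆-cong (operator-sound t) ≈ᴹ-refl) ⟩
      -1₅ *ₗ ⁅ eval ⟦_⟧ʷ (operator t) , ⟦ a ⟧ ⁆   ≈⟨ *ₗ-congˡ (⋆-sound (operator t) a) ⟨
      -1₅ *ₗ eval ⟦_⟧ʷ (operator t ⋆ a)           ≈⟨ eval-· ⟦_⟧ʷ -1₅ (operator t ⋆ a) ⟨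
      eval ⟦_⟧ʷ (-1₅ · (operator t ⋆ a))          ∎

    expand-sound : ∀ p → eval ⟦_⟧ᶻ p ≈ᴹ eval ⟦_⟧ʷ (expand p)
    expand-sound []            = ≈ᴹ-refl
    expand-sound ((c , t) ∷ p) = begin
      c *ₗ ⟦ t ⟧ᶻ +ᴹ eval ⟦_⟧ᶻ p
        ≈⟨ +ᴹ-cong (*ₗ-congˡ (operator-sound t)) (expand-sound p) ⟩
      c *ₗ eval ⟦_⟧ʷ (operator t) +ᴹ eval ⟦_⟧ʷ (expand p)
        ≈⟨ +ᴹ-congʳ (eval-· ⟦_⟧ʷ c (operator t)) ⟨
      eval ⟦_⟧ʷ (c · operator t) +ᴹ eval ⟦_⟧ʷ (expand p)
        ≈⟨ eval-++ ⟦_⟧ʷ (c · operator t) (expand p) ⟨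
      eval ⟦_⟧ʷ (c · operator t ++ expand p) ∎

    Fact : Set ℓ
    Fact = Σ (Comb (ZTerm n)) λ p → eval ⟦_⟧ᶻ p ≈ᴹ 0ᴹ

    infixl 5 _◂ᶠ_
    _◂ᶠ_ : Fact → Term n → Fact
    (p , p≈0) ◂ᶠ a = map (map₂ (_◂ a)) p , (begin
      eval ⟦_⟧ᶻ (map (map₂ (_◂ a)) p)    ≡⟨ eval-map₂ ⟦_⟧ᶻ (_◂ a) p ⟩
      eval (λ t → ⁅ ⟦ t ⟧ᶻ , ⟦ a ⟧ ⁆) p  ≈⟨ eval-⁅⁆ˡ ⟦_⟧ᶻ p ⟦ a ⟧ ⟩
      ⁅ eval ⟦_⟧ᶻ p , ⟦ a ⟧ ⁆            ≈⟨ ⁅⁆-cong p≈0 ≈ᴹ-refl ⟩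
      ⁅ 0ᴹ , ⟦ a ⟧ ⁆                      ≈⟨ ⁅⁆-zeroˡ _ ⟩
      0ᴹ                                  ∎)

    combination : List (F₅ × Fact) → Comb (ZTerm n)
    combination []                  = []
    combination ((r , p , _) ∷ fs) = r · p ++ combination fs

    combination-vanishes : ∀ fs → eval ⟦_⟧ᶻ (combination fs) ≈ᴹ 0ᴹ
    combination-vanishes []                    = ≈ᴹ-refl
    combination-vanishes ((r , p , p≈0) ∷ fs) = begin
      eval ⟦_⟧ᶻ (r · p ++ combination fs)               ≈⟨ eval-++ ⟦_⟧ᶻ (r · p) _ ⟩
      eval ⟦_⟧ᶻ (r · p) +ᴹ eval ⟦_⟧ᶻ (combination fs)  ≈⟨ +ᴹ-cong (eval-· ⟦_⟧ᶻ r p) (combination-vanishes fs) ⟩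
      r *ₗ eval ⟦_⟧ᶻ p +ᴹ 0ᴹ                            ≈⟨ +ᴹ-identityʳ _ ⟩
      r *ₗ eval ⟦_⟧ᶻ p                                  ≈⟨ *ₗ-congˡ p≈0 ⟩
      r *ₗ 0ᴹ                                           ≈⟨ *ₗ-zeroʳ r ⟩
      0ᴹ                                                ∎

    solve : (goal : Comb (ZTerm n)) (facts : List (F₅ × Fact)) →
            {True (vanishes? (normalForm (goal ++ combination facts)))} →
            eval ⟦_⟧ᶻ goal ≈ᴹ 0ᴹ
    solve goal facts {normal-form-vanishes} = begin
      eval ⟦_⟧ᶻ goal                                    ≈⟨ +ᴹ-identityʳ _ ⟨
      eval ⟦_⟧ᶻ goal +ᴹ 0ᴹ                              ≈⟨ +ᴹ-congˡ (combination-vanishes facts) ⟨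
      eval ⟦_⟧ᶻ goal +ᴹ eval ⟦_⟧ᶻ (combination facts)  ≈⟨ eval-++ ⟦_⟧ᶻ goal (combination facts) ⟨
      eval ⟦_⟧ᶻ whole                                   ≈⟨ expand-sound whole ⟩
      eval ⟦_⟧ʷ (expand whole)                          ≈⟨ eval-collect ⟦_⟧ʷ (≡-dec Finₚ._≟_) (expand whole) ⟨
      eval ⟦_⟧ʷ (normalForm whole)                      ≈⟨ eval-vanishing ⟦_⟧ʷ _ (toWitness normal-form-vanishes) ⟩
      0ᴹ                                                ∎
      where whole = goal ++ combination facts

    solve₂ : (s : ZTerm n) (c : F₅) (t : ZTerm n) (facts : List (F₅ × Fact)) →
             {True (vanishes? (normalForm ((1₅ , s) ∷ (c , t) ∷ combination facts)))} →
             ⟦ s ⟧ᶻ +ᴹ c *ₗ ⟦ t ⟧ᶻ ≈ᴹ 0ᴹ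
    solve₂ s c t facts {normal-form-vanishes} =
      ≈ᴹ-trans (≈ᴹ-sym (+ᴹ-cong (*ₗ-identityˡ ⟦ s ⟧ᶻ) (+ᴹ-identityʳ _)))
               (solve ((1₅ , s) ∷ (c , t) ∷ []) facts {normal-form-vanishes})

  f-⁅⁆-comm : ∀ z a b → f L z ⁅ a , b ⁆ ≈ᴹ f L z ⁅ b , a ⁆
  f-⁅⁆-comm z a b = x∙y⁻¹≈ε⇒x≈y _ _ (begin
    f L z ⁅ a , b ⁆ +ᴹ -ᴹ f L z ⁅ b , a ⁆      ≈⟨ +ᴹ-congˡ (-1₅*ₗ≈-ᴹ _) ⟨
    f L z ⁅ a , b ⁆ +ᴹ -1₅ *ₗ f L z ⁅ b , a ⁆  ≈⟨ solve₂ (ẑ ◂ αβ ◂ αβ) -1₅ (ẑ ◂ βα ◂ βα) [] ⟩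
    0ᴹ                                         ∎)
    where
    open Semantics z (lookup (a Vec.∷ b Vec.∷ Vec.[]))
    αβ βα : Term 2
    αβ = ⁅ var (# 0) , var (# 1) ⁆ₜ
    βα = ⁅ var (# 1) , var (# 0) ⁆ₜ

  module Engel (engel : Is3Engel L) where

    module _ {n} {z : Carrierᴹ} {ρ : Fin n → Carrierᴹ} where
      open Semantics z ρ

      engelᶠ : ZTerm n → Term n → Fact
      engelᶠ x a = [ 1₅ , x ◂ a ◂ a ◂ a ] ,
        ≈ᴹ-trans (+ᴹ-identityʳ _) (≈ᴹ-trans (*ₗ-identityˡ _) (engel _ _))

    engel-linearised : (x a b c : Carrierᴹ) →
      let open Semantics x (lookup (a Vec.∷ b Vec.∷ c Vec.∷ Vec.[])) in
      eval ⟦_⟧ᶻ (linearised ẑ (var (# 0)) (var (# 1)) (var (# 2))) ≈ᴹ 0ᴹ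
    engel-linearised x a b c = solve (linearised ẑ α β γ)
      ( (-1₅ , engelᶠ ẑ (α ⊕ β ⊕ γ))
      ∷ (1₅ , engelᶠ ẑ (α ⊕ β)) ∷ (1₅ , engelᶠ ẑ (α ⊕ γ)) ∷ (1₅ , engelᶠ ẑ (β ⊕ γ))
      ∷ (-1₅ , engelᶠ ẑ α) ∷ (-1₅ , engelᶠ ẑ β) ∷ (-1₅ , engelᶠ ẑ γ) ∷ [])
      where
      open Semantics x (lookup (a Vec.∷ b Vec.∷ c Vec.∷ Vec.[]))
      α β γ : Term 3
      α = var (# 0)
      β = var (# 1)
      γ = var (# 2)

    -- Both combinations evaluate term by term to the elements of
    -- linearised ẑ α β γ, so engel-linearised proves them verbatim.
    module _ {n} {z : Carrierᴹ} {ρ : Fin n → Carrierᴹ} where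
      open Semantics z ρ

      linearisedᶠ : ZTerm n → Term n → Term n → Term n → Fact
      linearisedᶠ x a b c = linearised x a b c , engel-linearised ⟦ x ⟧ᶻ ⟦ a ⟧ ⟦ b ⟧ ⟦ c ⟧

      linearised-argᶠ : Term n → ZTerm n → Term n → Term n → Fact
      linearised-argᶠ x a b c = linearised-arg x a b c , engel-linearised ⟦ x ⟧ ⟦ a ⟧ᶻ ⟦ b ⟧ ⟦ c ⟧

    -- The coefficients solve a linear system over 𝔽₅ in the six words of
    -- bidegree (2,2) in ad a, ad b.
    f-⁅⁆ : ∀ z a b → f L z ⁅ a , b ⁆ +ᴹ f L (f L z a) b ≈ᴹ 0ᴹ
    f-⁅⁆ z a b = begin
      f L z ⁅ a , b ⁆ +ᴹ f L (f L z a) b        ≈⟨ +ᴹ-congˡ (*ₗ-identityˡ _) ⟨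
      f L z ⁅ a , b ⁆ +ᴹ 1₅ *ₗ f L (f L z a) b  ≈⟨ solve₂ (ẑ ◂ αβ ◂ αβ) 1₅ (ẑ ◂ α ◂ α ◂ β ◂ β) certificate ⟩
      0ᴹ                                        ∎
      where
      open Semantics z (lookup (a Vec.∷ b Vec.∷ Vec.[]))
      α β αβ : Term 2
      α  = var (# 0)
      β  = var (# 1)
      αβ = ⁅ α , β ⁆ₜ
      certificate : List (F₅ × Fact)
      certificate = (# 3 , linearisedᶠ ẑ α α β ◂ᶠ β)
                  ∷ (-1₅ , linearisedᶠ (ẑ ◂ α) β β α)
                  ∷ (-1₅ , linearised-argᶠ β ẑ α β ◂ᶠ α) ∷ []

    f-⁅⁆≈-f-f : ∀ z a b → f L z ⁅ a , b ⁆ ≈ᴹ -ᴹ f L (f L z a) b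
    f-⁅⁆≈-f-f z a b = inverseˡ-unique _ _ (f-⁅⁆ z a b)

    f-f-comm : ∀ z a b → f L (f L z a) b ≈ᴹ f L (f L z b) a
    f-f-comm z a b = begin
      f L (f L z a) b     ≈⟨ inverseʳ-unique _ _ (f-⁅⁆ z a b) ⟩
      -ᴹ f L z ⁅ a , b ⁆  ≈⟨ -ᴹ‿cong (f-⁅⁆-comm z a b) ⟩
      -ᴹ f L z ⁅ b , a ⁆  ≈⟨ inverseʳ-unique _ _ (f-⁅⁆ z b a) ⟨
      f L (f L z b) a     ∎

    f-f-⁅⁆-swapʳ : ∀ z a b c → f L (f L z ⁅ a , b ⁆) c ≈ᴹ f L (f L z ⁅ a , c ⁆) b
    f-f-⁅⁆-swapʳ z a b c = begin
      f L (f L z ⁅ a , b ⁆) c          ≈⟨ f-congˡ c (f-⁅⁆≈-f-f z a b) ⟩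
      f L (-ᴹ f L (f L z a) b) c       ≈⟨ f-negˡ _ c ⟩
      -ᴹ f L (f L (f L z a) b) c       ≈⟨ -ᴹ‿cong (f-f-comm (f L z a) b c) ⟩
      -ᴹ f L (f L (f L z a) c) b       ≈⟨ f-negˡ _ b ⟨
      f L (-ᴹ f L (f L z a) c) b       ≈⟨ f-congˡ b (f-⁅⁆≈-f-f z a c) ⟨
      f L (f L z ⁅ a , c ⁆) b          ∎

    f-f-⁅⁆-rotate : ∀ z a b c → f L (f L z ⁅ a , b ⁆) c ≈ᴹ f L (f L z ⁅ b , c ⁆) a
    f-f-⁅⁆-rotate z a b c =
      ≈ᴹ-trans (f-congˡ c (f-⁅⁆-comm z a b)) (f-f-⁅⁆-swapʳ z b a c)

    f-f-⁅⁆-transfer : ∀ {z a b c a′ b′ c′} →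
                      f L z ⁅ b , c ⁆ ≈ᴹ f L z ⁅ b′ , c′ ⁆ → f L z ⁅ a , b′ ⁆ ≈ᴹ f L z ⁅ a′ , b ⁆ →
                      f L (f L z ⁅ a , b ⁆) c ≈ᴹ f L (f L z ⁅ a′ , b ⁆) c′
    f-f-⁅⁆-transfer {z} {a} {b} {c} {a′} {b′} {c′} bc≈b′c′ ab′≈a′b = begin
      f L (f L z ⁅ a , b ⁆) c    ≈⟨ f-f-⁅⁆-rotate z a b c ⟩
      f L (f L z ⁅ b , c ⁆) a    ≈⟨ f-congˡ a bc≈b′c′ ⟩
      f L (f L z ⁅ b′ , c′ ⁆) a  ≈⟨ f-f-⁅⁆-rotate z a b′ c′ ⟨
      f L (f L z ⁅ a , b′ ⁆) c′  ≈⟨ f-congˡ c′ ab′≈a′b ⟩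
      f L (f L z ⁅ a′ , b ⁆) c′  ∎

    f-f-⁅⁆-vanishes : ∀ {z a b c} → f L z ⁅ b , c ⁆ ≈ᴹ 0ᴹ → f L (f L z ⁅ a , b ⁆) c ≈ᴹ 0ᴹ
    f-f-⁅⁆-vanishes {z} {a} {b} {c} bc≈0 = begin
      f L (f L z ⁅ a , b ⁆) c  ≈⟨ f-f-⁅⁆-rotate z a b c ⟩
      f L (f L z ⁅ b , c ⁆) a  ≈⟨ f-congˡ a bc≈0 ⟩
      f L 0ᴹ a                 ≈⟨ f-zeroˡ a ⟩
      0ᴹ                       ∎

    f-⁅⁆-vanishes : ∀ {z a b} → f L (f L z a) b ≈ᴹ 0ᴹ → f L z ⁅ a , b ⁆ ≈ᴹ 0ᴹ
    f-⁅⁆-vanishes {z} {a} {b} ffzab≈0 = begin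
      f L z ⁅ a , b ⁆                     ≈⟨ f-⁅⁆≈-f-f z a b ⟩
      -ᴹ f L (f L z a) b                  ≈⟨ -ᴹ‿cong ffzab≈0 ⟩
      -ᴹ 0ᴹ                               ≈⟨ ε⁻¹≈ε ⟩
      0ᴹ                                  ∎

mainTheorem6 : {m ℓ : Level} (L : LieAlgebra m ℓ) → Is3Engel L →
               (k l : ℕ) → 1 < k → k < l →
               (z₀ z₁ z₂ z₃ : LieAlgebra.Carrierᴹ L) →
               ¬ (φ L k z₀ z₁ z₂ z₃ × ψ L l z₀ z₁ z₂ z₃)
mainTheorem6 L engel k l _ k<l z₀ z₁ z₂ z₃
             ((y , f≉0 , φ-step , φ-last) , (x , ψ-first , ψ-step)) =
  f≉0 (f-⁅⁆-vanishes (begin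
    f L (f L z₀ ⁅ z₂ , z₃ ⁆) (y 1)  ≈⟨ f-congˡ (y 1) ψ-first ⟩
    Q 1                             ≈⟨ telescope ≈ᴹ-setoid Q k Q-step ⟩
    Q (suc k)                       ≈⟨ f-f-⁅⁆-vanishes φ-last ⟩
    0ᴹ                              ∎))
  where
  open LieAlgebra L
  open Properties L
  open Engel engel
  open import Relation.Binary.Reasoning.Setoid ≈ᴹ-setoid

  Q : ℕ → Carrierᴹ
  Q i = f L (f L z₀ ⁅ x i , z₁ ⁆) (y i)

  Q-step : ∀ i → 1 ≤ i → i ≤ k → Q i ≈ᴹ Q (suc i)
  Q-step i 1≤i i≤k =
    f-f-⁅⁆-transfer (φ-step i 1≤i i≤k) (ψ-step i 1≤i (≤-trans (s≤s i≤k) k<l))
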